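{- Let $k = k(n)$ and $r = r(n)$ be positive integers with $k = o(\sqrt{n})$ and $r = \Omega(n)$. Consider the random temporal graph on $n$ nodes in which the underlying graph is the complete directed graph on $n$ nodes (every ordered pair $(u,v)$ of distinct nodes is an arc) and every arc independently receives a single time-label chosen uniformly at random from $[r]=\{1,2,\ldots,r\}$. Then the probability that this random temporal graph contains a journey of length $k$ tends to $1$ as $n \to \infty$.
   Context: A journey of length $k$ in a temporal digraph in which each arc has a single label is a directed path $(u_1,u_2,\ldots,u_{k+1})$ on $k+1$ pairwise distinct nodes whose consecutive arcs $(u_1,u_2),(u_2,u_3),\ldots,(u_k,u_{k+1})$ have strictly increasing labels. "Almost all random temporal graphs have property P" means that the probability of P tends to $1$ as $n\to\infty$. -}

module Defs where

open import Data.Nat using (ℕ; zero; suc; _+_; _*_; _^_; _≤_; _<_)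
open import Data.Fin using (Fin; zero; suc; toℕ; inject₁) renaming (_<_ to _<ᶠ_)
open import Data.Fin.Properties using (any?; all?; _≟_)
open import Data.Vec using (Vec; []; _∷_; lookup; tabulate; sum)
open import Data.Product using (Σ; ∃; _×_; _,_; proj₁; proj₂)
open import Relation.Binary.PropositionalEquality using (_≡_)
open import Relation.Nullary using (Dec; yes; no; _→-dec_; _×-dec_)
open import Relation.Nullary.Decidable using (map′)
import Data.Fin as F
import Data.Nat.Properties as ℕP

-- A temporal digraph on the complete digraph with node set Fin n, in which
-- every arc (u,v) carries one label from [r] (represented as Fin r, i.e.
-- labels 0..r-1, which is order-isomorphic to 1..r).  The row/column
-- representation also stores a "label" on the diagonal (u,u); it is never
-- used (journeys only use arcs between distinct nodes), and since every
-- entry is uniform and independent, counting over all r^(n*n) tables gives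
-- exactly the same probabilities as counting over the r^(n(n-1)) arc labelings.
Labeling : ℕ → ℕ → Set
Labeling n r = Vec (Vec (Fin r) n) n

label : ∀ {n r} → Labeling n r → Fin n → Fin n → Fin r
label L u v = lookup (lookup L u) v

Distinct : ∀ {n m} → Vec (Fin n) m → Set
Distinct {m = m} p = (i j : Fin m) → lookup p i ≡ lookup p j → i ≡ j

arcLabel : ∀ {n r k} → Labeling n r → Vec (Fin n) (suc k) → Fin k → Fin r
arcLabel L p i = label L (lookup p (inject₁ i)) (lookup p (suc i))

IncreasingLabels : ∀ {n r k} → Labeling n r → Vec (Fin n) (suc k) → Set
IncreasingLabels {k = k} L p =
  (i j : Fin k) → i <ᶠ j → toℕ (arcLabel L p i) < toℕ (arcLabel L p j)

IsJourney : ∀ {n r} (k : ℕ) → Labeling n r → Vec (Fin n) (suc k) → Set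
IsJourney k L p = Distinct p × IncreasingLabels L p

HasJourney : ∀ {n r} (k : ℕ) → Labeling n r → Set
HasJourney {n} k L = Σ (Vec (Fin n) (suc k)) (IsJourney k L)

∃Vec? : ∀ {n} m {P : Vec (Fin n) m → Set} → ((v : Vec (Fin n) m) → Dec (P v)) → Dec (∃ P)
∃Vec? zero P? = map′ (λ x → [] , x) (λ { ([] , x) → x }) (P? [])
∃Vec? (suc m) P? =
  map′ (λ { (a , xs , x) → a ∷ xs , x }) (λ { ((a ∷ xs) , x) → a , xs , x })
       (any? (λ a → ∃Vec? m (λ xs → P? (a ∷ xs))))

distinct? : ∀ {n m} (p : Vec (Fin n) m) → Dec (Distinct p)
distinct? p = all? (λ i → all? (λ j → (lookup p i ≟ lookup p j) →-dec (i ≟ j)))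

increasing? : ∀ {n r k} (L : Labeling n r) (p : Vec (Fin n) (suc k)) → Dec (IncreasingLabels L p)
increasing? L p = all? (λ i → all? (λ j → (i F.<? j) →-dec (toℕ (arcLabel L p i) ℕP.<? toℕ (arcLabel L p j))))

hasJourney? : ∀ {n r} (k : ℕ) (L : Labeling n r) → Dec (HasJourney k L)
hasJourney? k L = ∃Vec? (suc k) (λ p → distinct? p ×-dec increasing? L p)

sumFin : ∀ {r} → (Fin r → ℕ) → ℕ
sumFin f = sum (tabulate f)

sumVec : ∀ {B : Set} → ((B → ℕ) → ℕ) → (m : ℕ) → (Vec B m → ℕ) → ℕ
sumVec s zero f = f []
sumVec s (suc m) f = s (λ b → sumVec s m (λ xs → f (b ∷ xs)))

sumLabelings : ∀ n r → (Labeling n r → ℕ) → ℕ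
sumLabelings n r = sumVec (sumVec (sumFin {r}) n) n

indicator : ∀ {P : Set} → Dec P → ℕ
indicator (yes _) = 1
indicator (no _) = 0

-- number of labelings (out of r^(n*n), all equally likely) containing
-- a journey of length k
goodCount : (n r k : ℕ) → ℕ
goodCount n r k = sumLabelings n r (λ L → indicator (hasJourney? k L))

totalCount : (n r : ℕ) → ℕ
totalCount n r = r ^ (n * n)

-- Proof: a greedy search with geometric waiting times.  Put q = ⌊r/k⌋ and
-- cut the labels into the k consecutive intervals I_s = [s·q, s·q + q).  The
-- journey is grown backwards from node 0: the other nodes are scanned in
-- increasing order, and a node v is put in front of the current journey
-- (which starts at c) as soon as the arc v → c has its label in the current
-- interval; the search then moves one interval down.  Labels increase along
-- the result and the scanned nodes are fresh, so a successful search yields a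
-- journey (Greedy.search-sound).  Each scanned arc hits its interval with
-- probability at least q/r, so the expected number of scanned nodes is at
-- most k·r/q ≤ 2k² (Greedy.cost-bound, built on waiting-step), while a failed
-- search scans all n−1 other nodes (Greedy.scanned-all).  By Markov's
-- inequality P(no journey) ≤ 2k²/(n−1) (no-journey-bound), which is at most
-- 1/(e+1) for large n; r = Ω(n) only serves to guarantee k ≤ r.
--
-- Probabilities are counts of labellings: all sums are summation functionals
-- (Summation), of which only linearity and monotonicity are used.
module Submission where

open import Data.Nat
  using (ℕ; zero; suc; _+_; _*_; _^_; _∸_; _≤_; _<_; _≤?_; _⊔_; _/_; _%_; z≤n; s≤s; NonZero; >-nonZero)
open import Data.Nat.Properties
open import Data.Nat.DivMod using (m≡m%n+[m/n]*n; m%n<n; m/n*n≤m; m≥n⇒m/n>0)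
open import Data.Nat.Tactic.RingSolver using (solve-∀)
open import Data.Fin using (Fin; zero; suc; toℕ)
open import Data.Vec using (Vec; []; _∷_; lookup; tail)
open import Data.Bool using (Bool; true; false)
open import Data.Product using (∃; _×_; _,_; proj₁; proj₂)
open import Data.Empty using (⊥-elim)
open import Function using (_∘_)
open import Relation.Nullary using (yes; no; contradiction)
open import Relation.Binary.PropositionalEquality
open import Defs

open ≤-Reasoning

-- A summation functional on functions B → ℕ with total mass M: the
-- discrete integral w.r.t. the counting measure on a finite set of size M.
record Summation {B : Set} (S : (B → ℕ) → ℕ) (M : ℕ) : Set where
  field
    sum-ext   : ∀ {f g : B → ℕ} → (∀ x → f x ≡ g x) → S f ≡ S g
    sum-+     : ∀ (f g : B → ℕ) → S (λ x → f x + g x) ≡ S f + S g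
    sum-*     : ∀ a (f : B → ℕ) → S (λ x → a * f x) ≡ a * S f
    sum-const : ∀ a → S (λ _ → a) ≡ a * M
    sum-mono  : ∀ {f g : B → ℕ} → (∀ x → f x ≤ g x) → S f ≤ S g

open Summation

sumFin-summation : ∀ r → Summation (sumFin {r}) r
sumFin-summation zero = record
  { sum-ext = λ _ → refl ; sum-+ = λ _ _ → refl ; sum-* = λ a _ → sym (*-zeroʳ a)
  ; sum-const = λ a → sym (*-zeroʳ a) ; sum-mono = λ _ → z≤n }
sumFin-summation (suc r) = record
  { sum-ext   = λ f≗g → cong₂ _+_ (f≗g zero) (sum-ext rest (f≗g ∘ suc))
  ; sum-+     = λ f g → trans (cong (f zero + g zero +_) (sum-+ rest (f ∘ suc) (g ∘ suc)))
                              (interchange (f zero) (g zero) _ _)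
  ; sum-*     = λ a f → trans (cong (a * f zero +_) (sum-* rest a (f ∘ suc)))
                              (sym (*-distribˡ-+ a (f zero) _))
  ; sum-const = λ a → trans (cong (a +_) (sum-const rest a)) (sym (*-suc a r))
  ; sum-mono  = λ f≤g → +-mono-≤ (f≤g zero) (sum-mono rest (f≤g ∘ suc)) }
  where
  rest : Summation (sumFin {r}) r
  rest = sumFin-summation r
  interchange : ∀ a b c d → (a + b) + (c + d) ≡ (a + c) + (b + d)
  interchange = solve-∀

sumVec-summation : ∀ {B : Set} {S : (B → ℕ) → ℕ} {M} →
  Summation S M → ∀ m → Summation (sumVec S m) (M ^ m)
sumVec-summation σ zero = record
  { sum-ext = λ f≗g → f≗g [] ; sum-+ = λ _ _ → refl ; sum-* = λ _ _ → refl
  ; sum-const = λ a → sym (*-identityʳ a) ; sum-mono = λ f≤g → f≤g [] }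
sumVec-summation {S = S} {M} σ (suc m) = record
  { sum-ext   = λ f≗g → sum-ext σ (λ b → sum-ext tails (λ xs → f≗g (b ∷ xs)))
  ; sum-+     = λ f g → trans (sum-ext σ (λ b → sum-+ tails (λ xs → f (b ∷ xs)) (λ xs → g (b ∷ xs))))
                              (sum-+ σ _ _)
  ; sum-*     = λ a f → trans (sum-ext σ (λ b → sum-* tails a (λ xs → f (b ∷ xs)))) (sum-* σ a _)
  ; sum-const = λ a → trans (sum-ext σ (λ _ → sum-const tails a))
                            (trans (sum-const σ _) (reassoc a M (M ^ m)))
  ; sum-mono  = λ f≤g → sum-mono σ (λ b → sum-mono tails (λ xs → f≤g (b ∷ xs))) }
  where
  tails : Summation (sumVec S m) (M ^ m)
  tails = sumVec-summation σ m
  reassoc : ∀ a M P → (a * P) * M ≡ a * (M * P)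
  reassoc = solve-∀

sum-suc : ∀ {B : Set} {S : (B → ℕ) → ℕ} {M} → Summation S M →
  ∀ (f : B → ℕ) → S (λ x → suc (f x)) ≡ M + S f
sum-suc {S = S} {M} σ f =
  trans (sum-+ σ (λ _ → 1) f) (cong (_+ S f) (trans (sum-const σ 1) (*-identityˡ M)))

-- A function of one coordinate of a vector of length 1+m is summed M^m times
-- over: the marginal of a product of uniform distributions is uniform.
sum-coordinate : ∀ {B : Set} {S : (B → ℕ) → ℕ} {M} → Summation S M →
  ∀ m (c : Fin (suc m)) (g : B → ℕ) → sumVec S (suc m) (λ v → g (lookup v c)) ≡ S g * M ^ m
sum-coordinate {S = S} {M} σ m zero g = begin-equality
  S (λ b → sumVec S m (λ _ → g b)) ≡⟨ sum-ext σ (λ b → trans (sum-const (sumVec-summation σ m) (g b))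
                                                            (*-comm (g b) (M ^ m))) ⟩
  S (λ b → M ^ m * g b)            ≡⟨ sum-* σ (M ^ m) g ⟩
  M ^ m * S g                      ≡⟨ *-comm (M ^ m) (S g) ⟩
  S g * M ^ m                      ∎
sum-coordinate {S = S} {M} σ (suc m) (suc c) g = begin-equality
  S (λ _ → sumVec S (suc m) (λ v → g (lookup v c))) ≡⟨ sum-ext σ (λ _ → sum-coordinate σ m c g) ⟩
  S (λ _ → S g * M ^ m)                             ≡⟨ sum-const σ _ ⟩
  S g * M ^ m * M                                   ≡⟨ reassoc (S g) M (M ^ m) ⟩
  S g * (M * M ^ m)                                 ∎
  where
  reassoc : ∀ a M P → (a * P) * M ≡ a * (M * P)
  reassoc = solve-∀

branch : {A : Set} → ℕ → A → A → A
branch zero    a b = b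
branch (suc _) a b = a

sum-branch : ∀ {B : Set} (S : (B → ℕ) → ℕ) w (f g : B → ℕ) →
  S (λ x → branch w (f x) (g x)) ≡ branch w (S f) (S g)
sum-branch S zero    f g = refl
sum-branch S (suc _) f g = refl

-- One round of waiting for a success.  Outcomes x (total mass N) succeed when
-- w x = 1, with total weight at least G.  If the cost f x satisfies
-- G·f x + K·w x ≤ G·P + (s+1)·K for K = N·P (cost P + s·K/G after a success,
-- P + (s+1)·K/G after a failure), then the total cost is G·S f ≤ (s+1)·N·K.
waiting-step : ∀ {B : Set} {S : (B → ℕ) → ℕ} {N} → Summation S N →
  ∀ (w f : B → ℕ) G P s → G ≤ S w →
  (∀ x → G * f x + N * P * w x ≤ G * P + suc s * (N * P)) →
  G * S f ≤ suc s * (N * (N * P))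
waiting-step {S = S} {N} σ w f G P s hits step = +-cancelʳ-≤ (K * G) _ _ (begin
  G * S f + K * G                        ≤⟨ +-monoʳ-≤ (G * S f) (*-monoʳ-≤ K hits) ⟩
  G * S f + K * S w                      ≡⟨ sym (cong₂ _+_ (sum-* σ G f) (sum-* σ K w)) ⟩
  S (λ x → G * f x) + S (λ x → K * w x) ≡⟨ sym (sum-+ σ _ _) ⟩
  S (λ x → G * f x + K * w x)            ≤⟨ sum-mono σ step ⟩
  S (λ _ → G * P + suc s * K)            ≡⟨ sum-const σ _ ⟩
  (G * P + suc s * K) * N                ≡⟨ rearrange G P N (suc s) ⟩
  suc s * (N * K) + K * G                ∎)
  where
  K : ℕ
  K = N * P
  rearrange : ∀ G P N t → (G * P + t * (N * P)) * N ≡ t * (N * (N * P)) + N * P * G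
  rearrange = solve-∀

inInterval : ℕ → ℕ → ℕ → ℕ
inInterval (suc a) b       zero    = 0
inInterval (suc a) b       (suc i) = inInterval a b i
inInterval zero    zero    i       = 0
inInterval zero    (suc b) zero    = 1
inInterval zero    (suc b) (suc i) = inInterval zero b i

inInterval≤1 : ∀ a b i → inInterval a b i ≤ 1
inInterval≤1 (suc a) b       zero    = z≤n
inInterval≤1 (suc a) b       (suc i) = inInterval≤1 a b i
inInterval≤1 zero    zero    i       = z≤n
inInterval≤1 zero    (suc b) zero    = s≤s z≤n
inInterval≤1 zero    (suc b) (suc i) = inInterval≤1 zero b i

inInterval-sound : ∀ a b i x → inInterval a b i ≡ suc x → a ≤ i × i < a + b
inInterval-sound (suc a) b       (suc i) x eq =
  let a≤i , i<a+b = inInterval-sound a b i x eq in s≤s a≤i , s≤s i<a+b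
inInterval-sound zero    (suc b) zero    x eq = z≤n , s≤s z≤n
inInterval-sound zero    (suc b) (suc i) x eq = z≤n , s≤s (proj₂ (inInterval-sound zero b i x eq))

interval-size : ∀ r a b → a + b ≤ r → b ≤ sumFin {r} (λ x → inInterval a b (toℕ x))
interval-size r       zero    zero    _          = z≤n
interval-size (suc r) zero    (suc b) (s≤s fits) = s≤s (interval-size r zero b fits)
interval-size (suc r) (suc a) b       (s≤s fits) = interval-size r a b fits

interval-weight : ∀ n' r a q (c : Fin (suc n')) → a + q ≤ r →
  q * r ^ n' ≤ sumVec (sumFin {r}) (suc n') (λ row → inInterval a q (toℕ (lookup row c)))
interval-weight n' r a q c fits = begin
  q * r ^ n'                                      ≤⟨ *-monoˡ-≤ (r ^ n') (interval-size r a q fits) ⟩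
  sumFin {r} (λ x → inInterval a q (toℕ x)) * r ^ n' ≡⟨ sym (sum-coordinate (sumFin-summation r) n' c _) ⟩
  sumVec (sumFin {r}) (suc n') (λ row → inInterval a q (toℕ (lookup row c))) ∎

prepend : ∀ {n r t} (L : Labeling n r) (v : Fin n) (p : Vec (Fin n) (suc t)) →
  IsJourney t L p → (∀ j → lookup p j ≢ v) →
  (∀ i → toℕ (label L v (lookup p zero)) < toℕ (arcLabel L p i)) →
  IsJourney (suc t) L (v ∷ p)
prepend L v p (distinct , increasing) fresh below = distinct′ , increasing′
  where
  distinct′ : Distinct (v ∷ p)
  distinct′ zero    zero    _  = refl
  distinct′ zero    (suc j) eq = ⊥-elim (fresh j (sym eq))
  distinct′ (suc i) zero    eq = ⊥-elim (fresh i eq)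
  distinct′ (suc i) (suc j) eq = cong suc (distinct i j eq)
  increasing′ : IncreasingLabels L (v ∷ p)
  increasing′ zero    (suc j) _         = below j
  increasing′ (suc i) (suc j) (s≤s i<j) = increasing i j i<j

failed : Bool → ℕ
failed true  = 0
failed false = 1

failed-step : ∀ b m x → m * failed b ≤ x → suc m * failed b ≤ suc x
failed-step true  m x le = m≤n⇒m≤1+n le
failed-step false m x le = s≤s le

-- A row is the vector of labels of the arcs
-- leaving one node; the search scans rows whose nodes are given by ix.
module Greedy {n r : ℕ} (q : ℕ) where

  Row : Set
  Row = Vec (Fin r) n

  hit : ℕ → Fin n → Row → ℕ
  hit s c row = inInterval (s * q) q (toℕ (lookup row c))

  -- Success of the search for s more nodes in front of the current first node c.
  search : ℕ → ∀ {m} → Vec Row m → (Fin m → Fin n) → Fin n → Bool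
  search zero    rows         ix c = true
  search (suc s) []           ix c = false
  search (suc s) (row ∷ rows) ix c =
    branch (hit s c row) (search s rows (ix ∘ suc) (ix zero)) (search (suc s) rows (ix ∘ suc) c)

  scanned : ℕ → ∀ {m} → Vec Row m → (Fin m → Fin n) → Fin n → ℕ
  scanned zero    rows         ix c = 0
  scanned (suc s) []           ix c = 0
  scanned (suc s) (row ∷ rows) ix c =
    suc (branch (hit s c row) (scanned s rows (ix ∘ suc) (ix zero)) (scanned (suc s) rows (ix ∘ suc) c))

  -- A failed search has scanned all m rows (the event behind Markov's inequality).
  scanned-all : ∀ s {m} (rows : Vec Row m) ix c → m * failed (search s rows ix c) ≤ scanned s rows ix c
  scanned-all zero    {m} rows         ix c = ≤-reflexive (*-zeroʳ m)
  scanned-all (suc s)     []           ix c = z≤n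
  scanned-all (suc s) {suc m} (row ∷ rows) ix c with hit s c row
  ... | zero  = failed-step _ m _ (scanned-all (suc s) rows (ix ∘ suc) c)
  ... | suc _ = failed-step _ m _ (scanned-all s rows (ix ∘ suc) (ix zero))

  search-sound : ∀ (L : Labeling n r) s {m} (rows : Vec Row m) (ix : Fin m → Fin n) →
    (∀ i → lookup rows i ≡ lookup L (ix i)) →
    (∀ i j → toℕ i < toℕ j → toℕ (ix i) < toℕ (ix j)) →
    ∀ t (p : Vec (Fin n) (suc t)) → IsJourney t L p →
    (∀ i → s * q ≤ toℕ (arcLabel L p i)) →
    (∀ j i → toℕ (lookup p j) < toℕ (ix i)) →
    search s rows ix (lookup p zero) ≡ true → HasJourney (t + s) L
  search-sound L zero rows ix _ _ t p journey _ _ _ =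
    subst (λ l → HasJourney l L) (sym (+-identityʳ t)) (p , journey)
  search-sound L (suc s) [] ix _ _ t p _ _ _ ()
  search-sound L (suc s) (row ∷ rows) ix rows-of ordered t p journey above before success
    with hit s (lookup p zero) row in hit-eq
  ... | zero  = search-sound L (suc s) rows (ix ∘ suc) (rows-of ∘ suc) (λ i j → ordered (suc i) (suc j) ∘ s≤s)
                  t p journey above (λ j i → before j (suc i)) success
  ... | suc x = subst (λ l → HasJourney l L) (sym (+-suc t s))
                  (search-sound L s rows (ix ∘ suc) (rows-of ∘ suc) (λ i j → ordered (suc i) (suc j) ∘ s≤s)
                     (suc t) (v ∷ p) (prepend L v p journey fresh below) above′ before′ success)
    where
    v : Fin n
    v = ix zero
    ℓ : ℕ
    ℓ = toℕ (label L v (lookup p zero))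
    inside : s * q ≤ ℓ × ℓ < s * q + q
    inside = subst (λ rw → let ℓ′ = toℕ (lookup rw (lookup p zero)) in s * q ≤ ℓ′ × ℓ′ < s * q + q)
                   (rows-of zero) (inInterval-sound (s * q) q _ x hit-eq)
    fresh : ∀ j → lookup p j ≢ v
    fresh j eq = <-irrefl (cong toℕ eq) (before j zero)
    below : ∀ i → ℓ < toℕ (arcLabel L p i)
    below i = <-≤-trans (proj₂ inside) (≤-trans (≤-reflexive (+-comm (s * q) q)) (above i))
    above′ : ∀ i → s * q ≤ toℕ (arcLabel L (v ∷ p) i)
    above′ zero    = proj₁ inside
    above′ (suc i) = ≤-trans (m≤n+m (s * q) q) (above i)
    before′ : ∀ j i → toℕ (lookup (v ∷ p) j) < toℕ (ix (suc i))
    before′ zero    i = ordered zero (suc i) (s≤s z≤n)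
    before′ (suc j) i = before j (suc i)

  rowSum : (Row → ℕ) → ℕ
  rowSum = sumVec (sumFin {r}) n

  rowSum-summation : Summation rowSum (r ^ n)
  rowSum-summation = sumVec-summation (sumFin-summation r) n

  tuples : ∀ m → Summation (sumVec rowSum m) ((r ^ n) ^ m)
  tuples = sumVec-summation rowSum-summation

  -- Expected cost: if each of the first k intervals is hit with weight at
  -- least G (probability G / r^n), a search for s ≤ k nodes scans on
  -- average at most s·r^n/G rows.
  cost-bound : ∀ k G → (∀ s c → s < k → G ≤ rowSum (hit s c)) →
    ∀ m s → s ≤ k → (ix : Fin m → Fin n) (c : Fin n) →
    G * sumVec rowSum m (λ rows → scanned s rows ix c) ≤ s * (r ^ n) ^ suc m
  cost-bound k G hits zero    zero    _ ix c = ≤-reflexive (*-zeroʳ G)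
  cost-bound k G hits zero    (suc s) _ ix c = ≤-trans (≤-reflexive (*-zeroʳ G)) z≤n
  cost-bound k G hits (suc m) zero    _ ix c =
    ≤-reflexive (trans (cong (G *_) (sum-const (tuples (suc m)) 0)) (*-zeroʳ G))
  cost-bound k G hits (suc m) (suc s) s<k ix c =
    waiting-step rowSum-summation (hit s c) cost G P s (hits s c s<k) step
    where
    P K : ℕ
    P = (r ^ n) ^ m
    K = r ^ n * P
    after-hit after-miss : ℕ
    after-hit  = sumVec rowSum m (λ rows → scanned s rows (ix ∘ suc) (ix zero))
    after-miss = sumVec rowSum m (λ rows → scanned (suc s) rows (ix ∘ suc) c)
    cost : Row → ℕ
    cost row = sumVec rowSum m (λ rows → scanned (suc s) (row ∷ rows) ix c)
    cost-split : ∀ row → cost row ≡ P + branch (hit s c row) after-hit after-miss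
    cost-split row = trans (sum-suc (tuples m) _) (cong (P +_) (sum-branch (sumVec rowSum m) (hit s c row) _ _))
    by-outcome : ∀ w → w ≤ 1 → G * (P + branch w after-hit after-miss) + K * w ≤ G * P + suc s * K
    by-outcome zero _ = begin
      G * (P + after-miss) + K * 0 ≡⟨ expand G P after-miss K ⟩
      G * P + G * after-miss       ≤⟨ +-monoʳ-≤ (G * P) (cost-bound k G hits m (suc s) s<k (ix ∘ suc) c) ⟩
      G * P + suc s * K            ∎
      where
      expand : ∀ G P B K → G * (P + B) + K * 0 ≡ G * P + G * B
      expand = solve-∀
    by-outcome (suc zero) _ = begin
      G * (P + after-hit) + K * 1 ≡⟨ expand G P after-hit K ⟩
      G * P + (K + G * after-hit) ≤⟨ +-monoʳ-≤ (G * P) (+-monoʳ-≤ K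
                                       (cost-bound k G hits m s (<⇒≤ s<k) (ix ∘ suc) (ix zero))) ⟩
      G * P + suc s * K           ∎
      where
      expand : ∀ G P A K → G * (P + A) + K * 1 ≡ G * P + (K + G * A)
      expand = solve-∀
    by-outcome (suc (suc _)) (s≤s ())
    step : ∀ row → G * cost row + K * hit s c row ≤ G * P + suc s * K
    step row = begin
      G * cost row + K * hit s c row ≡⟨ cong (λ t → G * t + K * hit s c row) (cost-split row) ⟩
      G * (P + branch (hit s c row) after-hit after-miss) + K * hit s c row
        ≤⟨ by-outcome (hit s c row) (inInterval≤1 (s * q) q _) ⟩
      G * P + suc s * K              ∎

-- The search on the complete digraph on 1+n' nodes: row 0 holds the labels
-- leaving node 0, where the journey ends; the other n' rows are scanned.
module Analysis (n' r q k : ℕ) where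
  open Greedy {suc n'} {r} q public

  N : ℕ
  N = r ^ suc n'

  failures : ℕ
  failures = sumVec rowSum n' (λ rows → failed (search k rows suc zero))

  search-finds-journey : ∀ row₀ rows → search k rows suc zero ≡ true → HasJourney k (row₀ ∷ rows)
  search-finds-journey row₀ rows =
    search-sound (row₀ ∷ rows) k rows suc (λ _ → refl) (λ _ _ → s≤s)
      zero (zero ∷ []) ((λ { zero zero _ → refl }) , (λ ())) (λ ()) (λ { zero _ → s≤s z≤n })

  missing-journeys : totalCount (suc n') r ∸ goodCount (suc n') r k ≤ failures * N
  missing-journeys = m≤n+o⇒m∸n≤o _ _ (begin
    totalCount (suc n') r          ≡⟨ sym (^-*-assoc r (suc n') (suc n')) ⟩
    N ^ suc n'                     ≡⟨ sym (trans (sum-const labellings 1) (*-identityˡ _)) ⟩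
    sumLabelings (suc n') r (λ _ → 1)
      ≤⟨ sum-mono labellings covered ⟩
    sumLabelings (suc n') r (λ L → indicator (hasJourney? k L) + failed (search k (tail L) suc zero))
      ≡⟨ sum-+ labellings (λ L → indicator (hasJourney? k L)) (λ L → failed (search k (tail L) suc zero)) ⟩
    goodCount (suc n') r k + rowSum (λ _ → failures)
      ≡⟨ cong (goodCount (suc n') r k +_) (sum-const rowSum-summation failures) ⟩
    goodCount (suc n') r k + failures * N ∎)
    where
    labellings : Summation (sumLabelings (suc n') r) (N ^ suc n')
    labellings = tuples (suc n')
    covered : ∀ L → 1 ≤ indicator (hasJourney? k L) + failed (search k (tail L) suc zero)
    covered (row₀ ∷ rows) with search k rows suc zero in found
    ... | false = m≤n+m 1 _
    ... | true with hasJourney? k (row₀ ∷ rows)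
    ...   | yes _  = s≤s z≤n
    ...   | no ¬j = ⊥-elim (¬j (search-finds-journey row₀ rows found))

  -- Markov's inequality: each failure costs n' scanned rows, and the expected
  -- number of scanned rows is at most k·r/q when the k intervals fit in [r].
  failure-weight : k * q ≤ r → q * r ^ n' * (n' * failures) ≤ k * N ^ suc n'
  failure-weight kq≤r = begin
    G * (n' * failures)
      ≡⟨ cong (G *_) (sym (sum-* (tuples n') n' _)) ⟩
    G * sumVec rowSum n' (λ rows → n' * failed (search k rows suc zero))
      ≤⟨ *-monoʳ-≤ G (sum-mono (tuples n') (λ rows → scanned-all k rows suc zero)) ⟩
    G * sumVec rowSum n' (λ rows → scanned k rows suc zero)
      ≤⟨ cost-bound k G hits n' k ≤-refl suc zero ⟩
    k * N ^ suc n' ∎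
    where
    G : ℕ
    G = q * r ^ n'
    hits : ∀ s c → s < k → G ≤ rowSum (hit s c)
    hits s c s<k = interval-weight n' r (s * q) q c
      (≤-trans (≤-reflexive (+-comm (s * q) q)) (≤-trans (*-monoˡ-≤ q s<k) kq≤r))

interval-width : ∀ r k .{{_ : NonZero k}} → k ≤ r →
  k * (r / k) ≤ r × 1 ≤ r / k × r ≤ 2 * (r / k) * k
interval-width r k k≤r = fits , nonempty , half
  where
  q : ℕ
  q = r / k
  fits : k * q ≤ r
  fits = ≤-trans (≤-reflexive (*-comm k q)) (m/n*n≤m r k)
  nonempty : 1 ≤ q
  nonempty = m≥n⇒m/n>0 k≤r
  half : r ≤ 2 * q * k
  half = begin
    r             ≡⟨ m≡m%n+[m/n]*n r k ⟩
    r % k + q * k ≤⟨ +-monoˡ-≤ (q * k) (<⇒≤ (m%n<n r k)) ⟩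
    k + q * k     ≤⟨ +-monoˡ-≤ (q * k) (≤-trans (≤-reflexive (sym (*-identityˡ k))) (*-monoˡ-≤ k nonempty)) ⟩
    q * k + q * k ≡⟨ double q k ⟩
    2 * q * k     ∎
    where
    double : ∀ q k → q * k + q * k ≡ 2 * q * k
    double = solve-∀

no-journey-bound : ∀ n' r k → 1 ≤ k → k ≤ r →
  n' * (totalCount (suc n') r ∸ goodCount (suc n') r k) ≤ 2 * k ^ 2 * totalCount (suc n') r
no-journey-bound n' r k k≥1 k≤r = *-cancelˡ-≤ G (begin
  G * (n' * (total ∸ good))          ≤⟨ *-monoʳ-≤ G (*-monoʳ-≤ n' missing-journeys) ⟩
  G * (n' * (failures * N))          ≡⟨ regroup G n' failures N ⟩
  G * (n' * failures) * N            ≤⟨ *-monoˡ-≤ N (failure-weight fits) ⟩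
  k * N ^ suc n' * N                 ≡⟨ expose k r (r ^ n') (N ^ n') ⟩
  k * r * (r ^ n' * N ^ n' * N)      ≤⟨ *-monoˡ-≤ (r ^ n' * N ^ n' * N) (*-monoʳ-≤ k half) ⟩
  k * (2 * q * k) * (r ^ n' * N ^ n' * N) ≡⟨ collect k q (r ^ n') (N ^ n') N ⟩
  G * (2 * k ^ 2 * (N * N ^ n'))     ≡⟨ cong (λ t → G * (2 * k ^ 2 * t)) (^-*-assoc r (suc n') (suc n')) ⟩
  G * (2 * k ^ 2 * total)            ∎)
  where
  instance
    k≢0 : NonZero k
    k≢0 = >-nonZero k≥1
    r≢0 : NonZero r
    r≢0 = >-nonZero (≤-trans k≥1 k≤r)
  q total good : ℕ
  q = r / k
  total = totalCount (suc n') r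
  good = goodCount (suc n') r k
  open Analysis n' r q k
  fits : k * q ≤ r
  fits = proj₁ (interval-width r k k≤r)
  half : r ≤ 2 * q * k
  half = proj₂ (proj₂ (interval-width r k k≤r))
  G : ℕ
  G = q * r ^ n'
  instance
    G≢0 : NonZero G
    G≢0 = m*n≢0 q (r ^ n') {{>-nonZero (proj₁ (proj₂ (interval-width r k k≤r)))}} {{m^n≢0 r n'}}
  regroup : ∀ a b c d → a * (b * (c * d)) ≡ a * (b * c) * d
  regroup = solve-∀
  expose : ∀ a b c d → a * ((b * c) * d) * (b * c) ≡ a * b * (c * d * (b * c))
  expose = solve-∀
  collect : ∀ a b c d x → a * (2 * b * a) * (c * d * x) ≡ b * c * (2 * (a * (a * 1)) * (x * d))
  collect = solve-∀

square-pos : ∀ {k} → 1 ≤ k → 1 ≤ k ^ 2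
square-pos k≥1 = *-mono-≤ k≥1 (*-mono-≤ k≥1 (≤-refl {1}))

≤-square : ∀ {k} → 1 ≤ k → k ≤ k ^ 2
≤-square {k} k≥1 =
  ≤-trans (≤-reflexive (sym (*-identityʳ k))) (*-monoʳ-≤ k (≤-trans k≥1 (≤-reflexive (sym (*-identityʳ k)))))

room : ∀ {m k n} → 1 ≤ k → suc m * k ^ 2 ≤ n → m * k ^ 2 < n
room {m} {k} k≥1 large = ≤-trans (+-monoˡ-≤ (m * k ^ 2) (square-pos k≥1)) large

≤-from-square : ∀ c k r → 1 ≤ k → suc c * k ^ 2 ≤ c * r → k ≤ r
≤-from-square c k r k≥1 large with k ≤? r
... | yes k≤r = k≤r
... | no k≰r = contradiction large (<⇒≱ (begin-strict
  c * r           ≤⟨ *-monoʳ-≤ c (<⇒≤ (≰⇒> k≰r)) ⟩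
  c * k           ≤⟨ *-monoʳ-≤ c (≤-square k≥1) ⟩
  c * k ^ 2       <⟨ m<n+m (c * k ^ 2) (square-pos k≥1) ⟩
  suc c * k ^ 2   ∎))

scale-down : ∀ e a b d n' → 1 ≤ d → n' * a ≤ d * b → suc e * d ≤ n' → suc e * a ≤ b
scale-down e a b d n' d≥1 bound large = *-cancelˡ-≤ d {{>-nonZero d≥1}} (begin
  d * (suc e * a) ≡⟨ swap d (suc e) a ⟩
  suc e * d * a   ≤⟨ *-monoˡ-≤ a large ⟩
  n' * a          ≤⟨ bound ⟩
  d * b           ∎)
  where
  swap : ∀ d e a → d * (e * a) ≡ e * d * a
  swap = solve-∀

Eventually : (ℕ → Set) → Set
Eventually P = ∃ λ N → ∀ n → N ≤ n → P n

eventually-× : ∀ {P Q : ℕ → Set} → Eventually P → Eventually Q → Eventually (λ n → P n × Q n)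
eventually-× (N₁ , p) (N₂ , q) =
  N₁ ⊔ N₂ , λ n N≤n → p n (≤-trans (m≤m⊔n N₁ N₂) N≤n) , q n (≤-trans (m≤n⊔m N₁ N₂) N≤n)

eventually-map : ∀ {P Q : ℕ → Set} → (∀ n → P n → Q n) → Eventually P → Eventually Q
eventually-map f (N , p) = N , λ n N≤n → f n (p n N≤n)

-- For large n: (2(e+1)+1)k² ≤ n makes 2k²/(n−1) ≤ 1/(e+1), and
-- (c+1)k² ≤ n ≤ c·r gives k ≤ r; then apply no-journey-bound.
mainTheorem2 : (k r : ℕ → ℕ) →
    (∀ n → 1 ≤ k n) → (∀ n → 1 ≤ r n) →
    (∀ e → ∃ λ N → ∀ n → N ≤ n → suc e * (k n ^ 2) ≤ n) →
    (∃ λ c → ∃ λ N → ∀ n → N ≤ n → n ≤ c * r n) →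
    ∀ e → ∃ λ N → ∀ n → N ≤ n →
    suc e * (totalCount n (r n) ∸ goodCount n (r n) (k n)) ≤ totalCount n (r n)
mainTheorem2 k r k≥1 _ small-k (c , linear-r) e =
  eventually-map conclude (eventually-× (eventually-× (small-k (suc e * 2)) (small-k c)) linear-r)
  where
  conclude : ∀ n → (suc (suc e * 2) * k n ^ 2 ≤ n × suc c * k n ^ 2 ≤ n) × n ≤ c * r n →
    suc e * (totalCount n (r n) ∸ goodCount n (r n) (k n)) ≤ totalCount n (r n)
  conclude n ((large , large′) , linear) with room {suc e * 2} (k≥1 n) large
  conclude zero _ | ()
  conclude (suc n') ((_ , large′) , linear) | s≤s spare =
    scale-down e _ _ (2 * k (suc n') ^ 2) n' (≤-trans (square-pos (k≥1 (suc n'))) (m≤m+n _ _))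
      (no-journey-bound n' (r (suc n')) (k (suc n')) (k≥1 (suc n'))
        (≤-from-square c (k (suc n')) (r (suc n')) (k≥1 (suc n')) (≤-trans large′ linear)))
      (≤-trans (≤-reflexive (sym (*-assoc (suc e) 2 (k (suc n') ^ 2)))) spare)
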